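{- Let $k\geq 2$ and $n\geq 4$ be integers. If $n$ is even, then \[\mathrm{R}_k(W_n)-1\geq \max\{(\mathrm{R}_{k-\ell}(K_4^-)-1)\cdot (\mathrm{R}_{\ell}(W_n)-1)\mid 1\leq \ell\leq k-1\}.\] If $n$ is odd, then \[\mathrm{R}_k(W_n)-1\geq \max\{(\mathrm{R}_{k-\ell}(K_3)-1)\cdot (\mathrm{R}_{\ell}(W_n)-1)\mid 1\leq \ell\leq k-1\}.\]
   Context: For an integer $n\geq 4$, the wheel $W_n$ is the graph on $n$ vertices obtained from the cycle $C_{n-1}$ by adding one new vertex adjacent to every vertex of the cycle. $K_4^-$ denotes the graph obtained from the complete graph $K_4$ by deleting one edge. For a graph $G$ and a positive integer $k$, $\mathrm{R}_k(G)$ is the smallest integer $N$ such that every coloring of the edges of $K_N$ with $k$ colors contains a monochromatic copy of $G$ (so $\mathrm{R}_1(G)=|V(G)|$). -}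

module Defs where

open import Data.Nat using (ℕ; zero; suc; _<_; _∸_)
open import Data.Fin using (Fin; toℕ)
open import Data.Fin.Patterns using (0F; 1F; 2F; 3F)
open import Data.Product using (_×_; Σ; ∃)
open import Data.Sum using (_⊎_)
open import Data.Empty using (⊥)
open import Data.Unit using (⊤)
open import Relation.Nullary using (¬_)
open import Relation.Binary.PropositionalEquality using (_≡_; _≢_)
open import Function.Definitions using (Injective)

-- A (simple) graph on the vertex set Fin size, given by an adjacency relation.
-- All graphs defined below have irreflexive symmetric adjacency.
record Graph : Set₁ where
  field
    size : ℕ
    Adj  : Fin size → Fin size → Set
open Graph public

K3 : Graph
K3 = record { size = 3 ; Adj = λ a b → a ≢ b }

K4⁻Adj : Fin 4 → Fin 4 → Set
K4⁻Adj 2F 3F = ⊥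
K4⁻Adj 3F 2F = ⊥
K4⁻Adj a  b  = a ≢ b

K4⁻ : Graph
K4⁻ = record { size = 4 ; Adj = K4⁻Adj }

RimStep : ℕ → ℕ → ℕ → Set
RimStep m i j = (suc i ≡ j) ⊎ ((i ≡ 1) × (j ≡ m))

-- Wheel W_n on Fin n: vertex 0 is the hub, vertices 1,...,n-1 form the
-- cycle C_{n-1} (in this cyclic order); the hub is adjacent to every rim vertex.
WheelAdj : (n : ℕ) → Fin n → Fin n → Set
WheelAdj n a b =
  (a ≢ b) ×
  ( (toℕ a ≡ 0) ⊎ (toℕ b ≡ 0)
  ⊎ RimStep (n ∸ 1) (toℕ a) (toℕ b) ⊎ RimStep (n ∸ 1) (toℕ b) (toℕ a))

W : ℕ → Graph
W n = record { size = n ; Adj = WheelAdj n }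

-- An edge colouring of K_N with k colours: a symmetric colour function on pairs
-- (the value on the diagonal is irrelevant).
record Colouring (N k : ℕ) : Set where
  field
    col : Fin N → Fin N → Fin k
    sym : ∀ i j → col i j ≡ col j i
open Colouring public

MonoCopy : ∀ {N k} → Colouring N k → Graph → Set
MonoCopy {N} {k} c G =
  Σ (Fin k) λ κ → Σ (Fin (size G) → Fin N) λ f →
    Injective _≡_ _≡_ f × (∀ a b → Adj G a b → col c (f a) (f b) ≡ κ)

Arrows : ℕ → ℕ → Graph → Set
Arrows N k G = (c : Colouring N k) → MonoCopy c G

IsRamseyNumber : ℕ → Graph → ℕ → Set
IsRamseyNumber k G N = Arrows N k G × (∀ M → M < N → ¬ Arrows M k G)

-- Blow-up: given a (k − ℓ)-colouring of K_{R_{k−ℓ}(H)−1} without a monochromatic H (H = K4⁻ for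
-- even n, K3 for odd n) and an ℓ-colouring of K_{R_ℓ(W_n)−1} without a monochromatic
-- W_n, replace every vertex of the first by a copy of the second, colour edges inside a
-- copy by the second colouring and edges between copies by the first, using disjoint
-- palettes. A monochromatic W_n in an inner colour lies inside one copy, since the hub
-- is adjacent to every other vertex. In an outer colour the copies it meets form a
-- monochromatic homomorphic image of W_n. Such an image always contains a triangle; for
-- even n the rim is an odd cycle, which cannot satisfy g(i) = g(i + 2) all the way
-- round, so three consecutive rim vertices hit three different copies, and with the hub
-- they span a K4⁻.
module Submission where

open import Defs
open import Data.Nat using (ℕ; suc; _+_; _*_; _∸_; _≤_; _<_; z≤n; s≤s; s≤s⁻¹; _≤?_)
open import Data.Nat.Properties
  using (≤-trans; <-trans; <⇒≤; n<1+n; m<n⇒m<1+n; <⇒≢; ≰⇒>; <⇒≤pred; *-zeroʳ; *-monoˡ-≤;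
         m∸n≤m; m+[n∸m]≡n; anyUpTo?)
open import Data.Nat.Divisibility using (_∣_; divides)
open import Data.Nat.DivMod using (_mod_; m<n⇒m%n≡m)
open import Data.Fin using (Fin; toℕ; inject≤; splitAt; join; remQuot; combine)
open import Data.Fin.Patterns using (0F; 1F; 2F; 3F)
open import Data.Fin.Properties
  using (_≟_; any?; toℕ-fromℕ<; inject≤-injective; splitAt-join; combine-remQuot)
open import Data.Vec using ([]; _∷_; lookup)
open import Data.Vec.Relation.Unary.All using ([]; _∷_)
open import Data.Vec.Relation.Unary.Unique.Propositional using (Unique; []; _∷_)
open import Data.Vec.Relation.Unary.Unique.Propositional.Properties using (lookup-injective)
open import Data.Product using (Σ; ∃; ∃-syntax; _×_; _,_; proj₁; proj₂; uncurry)
open import Data.Product.Properties using (×-≡,≡→≡)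
open import Data.Sum using (_⊎_; inj₁; inj₂; fromInj₁)
open import Function using (_∘_; _$_)
open import Function.Definitions using (Injective)
open import Relation.Nullary using (¬_; Dec; yes; no; ¬?; contradiction)
open import Relation.Nullary.Decidable using (_×-dec_; map′; decidable-stable)
open import Relation.Binary.Definitions using (DecidableEquality)
open import Relation.Binary.PropositionalEquality
  using (_≡_; _≢_; refl; trans; cong; subst; ≢-sym; module ≡-Reasoning) renaming (sym to ≡-sym)

restrict : ∀ {M N k} → M ≤ N → Colouring N k → Colouring M k
restrict M≤N c = record
  { col = λ a b → col c (inject≤ a M≤N) (inject≤ b M≤N)
  ; sym = λ a b → sym c (inject≤ a M≤N) (inject≤ b M≤N)
  }

Arrows-mono : ∀ {M N k G} → M ≤ N → Arrows M k G → Arrows N k G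
Arrows-mono M≤N M→G c with M→G (restrict M≤N c)
... | κ , f , f-inj , f-mono =
  κ , (λ a → inject≤ (f a) M≤N) , f-inj ∘ inject≤-injective M≤N M≤N _ _ , f-mono

MonoEdge : ∀ {N k} → Colouring N k → Fin k → Fin N → Fin N → Set
MonoEdge c κ x y = x ≢ y × col c x y ≡ κ

MonoEdge-sym : ∀ {N k} (c : Colouring N k) {κ x y} → MonoEdge c κ x y → MonoEdge c κ y x
MonoEdge-sym c {x = x} {y} (x≢y , xy) = ≢-sym x≢y , trans (sym c y x) xy

monoEdge? : ∀ {N k} (c : Colouring N k) κ x y → Dec (MonoEdge c κ x y)
monoEdge? c κ x y = ¬? (x ≟ y) ×-dec (col c x y ≟ κ)

-- A monochromatic homomorphic image of G: unlike MonoCopy, non-adjacent vertices may merge.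
MonoHom : ∀ {N k} → Colouring N k → Graph → Set
MonoHom {N} {k} c G =
  Σ (Fin k) λ κ → Σ (Fin (size G) → Fin N) λ h → ∀ a b → Adj G a b → MonoEdge c κ (h a) (h b)

Dominates : (G : Graph) → Fin (size G) → Set
Dominates G v = ∀ a → a ≢ v → Adj G v a

MonoTriangle : ∀ {N k} → Colouring N k → Set
MonoTriangle {N} {k} c = ∃[ κ ] ∃[ a ] ∃[ b ] ∃[ d ]
  MonoEdge c κ a b × MonoEdge c κ a d × MonoEdge c κ b d

monoTriangle? : ∀ {N k} (c : Colouring N k) → Dec (MonoTriangle c)
monoTriangle? c = any? λ κ → any? λ a → any? λ b → any? λ d →
  monoEdge? c κ a b ×-dec monoEdge? c κ a d ×-dec monoEdge? c κ b d

monoTriangle⇒monoCopy : ∀ {N k} {c : Colouring N k} → MonoTriangle c → MonoCopy c K3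
monoTriangle⇒monoCopy {c = c} (κ , a , b , d , ab , ad , bd) =
  κ , lookup (a ∷ b ∷ d ∷ []) , lookup-injective distinct _ _ , mono
  where
  distinct : Unique (a ∷ b ∷ d ∷ [])
  distinct = (proj₁ ab ∷ proj₁ ad ∷ []) ∷ (proj₁ bd ∷ []) ∷ [] ∷ []
  mono : ∀ x y → x ≢ y → col c (lookup (a ∷ b ∷ d ∷ []) x) (lookup (a ∷ b ∷ d ∷ []) y) ≡ κ
  mono 0F 1F _ = proj₂ ab
  mono 0F 2F _ = proj₂ ad
  mono 1F 2F _ = proj₂ bd
  mono 1F 0F _ = proj₂ (MonoEdge-sym c ab)
  mono 2F 0F _ = proj₂ (MonoEdge-sym c ad)
  mono 2F 1F _ = proj₂ (MonoEdge-sym c bd)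
  mono 0F 0F x≢x = contradiction refl x≢x
  mono 1F 1F x≢x = contradiction refl x≢x
  mono 2F 2F x≢x = contradiction refl x≢x

monoCopy⇒monoTriangle : ∀ {N k} {c : Colouring N k} → MonoCopy c K3 → MonoTriangle c
monoCopy⇒monoTriangle {c = c} (κ , f , f-inj , f-mono) =
  κ , f 0F , f 1F , f 2F , edge 0F 1F (λ ()) , edge 0F 2F (λ ()) , edge 1F 2F (λ ())
  where
  edge : ∀ x y → x ≢ y → MonoEdge c κ (f x) (f y)
  edge x y x≢y = x≢y ∘ f-inj , f-mono x y x≢y

monoK3? : ∀ {N k} (c : Colouring N k) → Dec (MonoCopy c K3)
monoK3? c = map′ (monoTriangle⇒monoCopy {c = c}) (monoCopy⇒monoTriangle {c = c}) (monoTriangle? c)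

-- u w v x span K4⁻ in the numbering of Defs, so the missing edge is v x.
MonoDiamond : ∀ {N k} → Colouring N k → Set
MonoDiamond {N} {k} c = ∃[ κ ] ∃[ u ] ∃[ w ] ∃[ v ] ∃[ x ]
  MonoEdge c κ u w × MonoEdge c κ u v × MonoEdge c κ u x ×
  MonoEdge c κ w v × MonoEdge c κ w x × v ≢ x

monoDiamond? : ∀ {N k} (c : Colouring N k) → Dec (MonoDiamond c)
monoDiamond? c = any? λ κ → any? λ u → any? λ w → any? λ v → any? λ x →
  monoEdge? c κ u w ×-dec monoEdge? c κ u v ×-dec monoEdge? c κ u x ×-dec
  monoEdge? c κ w v ×-dec monoEdge? c κ w x ×-dec ¬? (v ≟ x)

monoDiamond⇒monoCopy : ∀ {N k} {c : Colouring N k} → MonoDiamond c → MonoCopy c K4⁻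
monoDiamond⇒monoCopy {c = c} (κ , u , w , v , x , uw , uv , ux , wv , wx , v≢x) =
  κ , lookup (u ∷ w ∷ v ∷ x ∷ []) , lookup-injective distinct _ _ , mono
  where
  distinct : Unique (u ∷ w ∷ v ∷ x ∷ [])
  distinct = (proj₁ uw ∷ proj₁ uv ∷ proj₁ ux ∷ []) ∷ (proj₁ wv ∷ proj₁ wx ∷ []) ∷ (v≢x ∷ []) ∷ [] ∷ []
  mono : ∀ a b → K4⁻Adj a b →
    col c (lookup (u ∷ w ∷ v ∷ x ∷ []) a) (lookup (u ∷ w ∷ v ∷ x ∷ []) b) ≡ κ
  mono 0F 1F _ = proj₂ uw
  mono 0F 2F _ = proj₂ uv
  mono 0F 3F _ = proj₂ ux
  mono 1F 2F _ = proj₂ wv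
  mono 1F 3F _ = proj₂ wx
  mono 1F 0F _ = proj₂ (MonoEdge-sym c uw)
  mono 2F 0F _ = proj₂ (MonoEdge-sym c uv)
  mono 3F 0F _ = proj₂ (MonoEdge-sym c ux)
  mono 2F 1F _ = proj₂ (MonoEdge-sym c wv)
  mono 3F 1F _ = proj₂ (MonoEdge-sym c wx)
  mono 2F 3F ()
  mono 3F 2F ()
  mono 0F 0F a≢a = contradiction refl a≢a
  mono 1F 1F a≢a = contradiction refl a≢a
  mono 2F 2F a≢a = contradiction refl a≢a
  mono 3F 3F a≢a = contradiction refl a≢a

monoCopy⇒monoDiamond : ∀ {N k} {c : Colouring N k} → MonoCopy c K4⁻ → MonoDiamond c
monoCopy⇒monoDiamond {c = c} (κ , f , f-inj , f-mono) =
  κ , f 0F , f 1F , f 2F , f 3F ,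
  edge 0F 1F (λ ()) (λ ()) , edge 0F 2F (λ ()) (λ ()) , edge 0F 3F (λ ()) (λ ()) ,
  edge 1F 2F (λ ()) (λ ()) , edge 1F 3F (λ ()) (λ ()) , (λ ()) ∘ f-inj
  where
  edge : ∀ a b → a ≢ b → K4⁻Adj a b → MonoEdge c κ (f a) (f b)
  edge a b a≢b ab = a≢b ∘ f-inj , f-mono a b ab

monoK4⁻? : ∀ {N k} (c : Colouring N k) → Dec (MonoCopy c K4⁻)
monoK4⁻? c = map′ (monoDiamond⇒monoCopy {c = c}) (monoCopy⇒monoDiamond {c = c}) (monoDiamond? c)

module _ {M L j ℓ : ℕ} (c₁ : Colouring M j) (c₂ : Colouring L ℓ) where

  block : Fin (M * L) → Fin M
  block x = proj₁ (remQuot {M} L x)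

  position : Fin (M * L) → Fin L
  position x = proj₂ (remQuot {M} L x)

  block-position-injective : ∀ {x y} → block x ≡ block y → position x ≡ position y → x ≡ y
  block-position-injective {x} {y} ≡block ≡position = begin
    x                                  ≡⟨ combine-remQuot {M} L x ⟨
    uncurry combine (remQuot {M} L x)  ≡⟨ cong (uncurry combine) (×-≡,≡→≡ (≡block , ≡position)) ⟩
    uncurry combine (remQuot {M} L y)  ≡⟨ combine-remQuot {M} L y ⟩
    y                                  ∎
    where open ≡-Reasoning

  blockColour : Fin (M * L) → Fin (M * L) → Fin ℓ ⊎ Fin j
  blockColour x y with block x ≟ block y
  ... | yes _ = inj₁ (col c₂ (position x) (position y))
  ... | no  _ = inj₂ (col c₁ (block x) (block y))

  blockColour-sym : ∀ x y → blockColour x y ≡ blockColour y x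
  blockColour-sym x y with block x ≟ block y | block y ≟ block x
  ... | yes _     | yes _     = cong inj₁ (sym c₂ (position x) (position y))
  ... | yes x~y   | no  x≁y   = contradiction (≡-sym x~y) x≁y
  ... | no  x≁y   | yes y~x   = contradiction (≡-sym y~x) x≁y
  ... | no  _     | no  _     = cong inj₂ (sym c₁ (block x) (block y))

  blowUp : Colouring (M * L) (ℓ + j)
  blowUp = record
    { col = λ x y → join ℓ j (blockColour x y)
    ; sym = λ x y → cong (join ℓ j) (blockColour-sym x y)
    }

  inner-colour : ∀ {x y κ} → blockColour x y ≡ inj₁ κ →
    block x ≡ block y × col c₂ (position x) (position y) ≡ κ
  inner-colour {x} {y} e with block x ≟ block y | e
  ... | yes x~y | refl = x~y , refl

  outer-colour : ∀ {x y κ} → blockColour x y ≡ inj₂ κ → MonoEdge c₁ κ (block x) (block y)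
  outer-colour {x} {y} e with block x ≟ block y | e
  ... | no x≁y | refl = x≁y , refl

  blowUp-monoCopy : ∀ {G v} → Dominates G v → MonoCopy blowUp G → MonoCopy c₂ G ⊎ MonoHom c₁ G
  blowUp-monoCopy {G} {v} v-dominates (κ , f , f-inj , f-mono) = split (splitAt ℓ κ) λ a b ab →
    trans (≡-sym (splitAt-join ℓ j _)) (cong (splitAt ℓ) (f-mono a b ab))
    where
    split : ∀ s → (∀ a b → Adj G a b → blockColour (f a) (f b) ≡ s) → MonoCopy c₂ G ⊎ MonoHom c₁ G
    split (inj₁ κ₂) inner =
      inj₁ (κ₂ , position ∘ f , position-injective , λ a b ab → proj₂ (inner-colour (inner a b ab)))
      where
      block-of-v : ∀ a → block (f v) ≡ block (f a)
      block-of-v a with a ≟ v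
      ... | yes refl = refl
      ... | no a≢v   = proj₁ (inner-colour (inner v a (v-dominates a a≢v)))
      position-injective : Injective _≡_ _≡_ (position ∘ f)
      position-injective {a} {b} =
        f-inj ∘ block-position-injective (trans (≡-sym (block-of-v a)) (block-of-v b))
    split (inj₂ κ₁) outer = inj₂ (κ₁ , block ∘ f , λ a b ab → outer-colour (outer a b ab))

-- Deciding MonoCopy c₁ H is what makes the argument constructive: the refutations
-- ¬ Arrows do not hand us the colourings c₁ and c₂ to blow up.
module _ {G H : Graph} {v : Fin (size G)} (v-dominates : Dominates G v)
         (monoH? : ∀ {N k} (c : Colouring N k) → Dec (MonoCopy c H))
         (image⇒H : ∀ {N k} (c : Colouring N k) → MonoHom c G → MonoCopy c H) where

  ¬Arrows-* : ∀ {M L j ℓ} → ¬ Arrows M j H → ¬ Arrows L ℓ G → ¬ Arrows (M * L) (ℓ + j) G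
  ¬Arrows-* M↛H L↛G M*L→G = M↛H λ c₁ → decidable-stable (monoH? c₁) λ no-H-in-c₁ →
    L↛G λ c₂ → fromInj₁ (λ image → contradiction (image⇒H c₁ image) no-H-in-c₁)
                        (blowUp-monoCopy c₁ c₂ {G} v-dominates (M*L→G (blowUp c₁ c₂)))

  ramsey-product-bound : ∀ {j ℓ A L R} → IsRamseyNumber j H A → IsRamseyNumber ℓ G L →
    Arrows R (ℓ + j) G → (A ∸ 1) * (L ∸ 1) ≤ R ∸ 1
  ramsey-product-bound {A = 0} _ _ _ = z≤n
  ramsey-product-bound {A = suc A} {L = 0} _ _ _ rewrite *-zeroʳ A = z≤n
  ramsey-product-bound {A = suc A} {L = suc L} {R} (_ , A-least) (_ , L-least) R→G
    with R ≤? A * L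
  ... | yes R≤A*L = contradiction (Arrows-mono R≤A*L R→G)
                      (¬Arrows-* (A-least A (n<1+n A)) (L-least L (n<1+n L)))
  ... | no  R≰A*L = <⇒≤pred (≰⇒> R≰A*L)

module _ {a} {A : Set a} (g : ℕ → A) where

  even-steps-≡ : ∀ t → (∀ {i} → i < t → g (i * 2) ≡ g (2 + i * 2)) → g 0 ≡ g (t * 2)
  even-steps-≡ 0       _    = refl
  even-steps-≡ (suc t) step = trans (even-steps-≡ t (step ∘ m<n⇒m<1+n)) (step (n<1+n t))

  two-step-≢ : DecidableEquality A → ∀ t → g 0 ≢ g (t * 2) →
    ∃ λ i → i < t × g (i * 2) ≢ g (2 + i * 2)
  two-step-≢ _≟ᴬ_ t g0≢g2t with anyUpTo? (λ i → ¬? (g (i * 2) ≟ᴬ g (2 + i * 2))) t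
  ... | yes change   = change
  ... | no no-change = contradiction (even-steps-≡ t steady) g0≢g2t
    where
    steady : ∀ {i} → i < t → g (i * 2) ≡ g (2 + i * 2)
    steady {i} i<t =
      decidable-stable (g (i * 2) ≟ᴬ g (2 + i * 2)) λ changes → no-change (i , i<t , changes)

wheel-hub-dominates : ∀ {n} → Dominates (W (suc n)) 0F
wheel-hub-dominates a a≢0 = ≢-sym a≢0 , inj₁ refl

-- Vertices of W (suc m) by label.
module WheelVertex (m : ℕ) where

  vertex : ℕ → Fin (suc m)
  vertex i = i mod suc m

  toℕ-vertex : ∀ {i} → i < suc m → toℕ (vertex i) ≡ i
  toℕ-vertex i<1+m = trans (toℕ-fromℕ< _) (m<n⇒m%n≡m i<1+m)

  vertex-≢ : ∀ {i i′} → i < suc m → i′ < suc m → i ≢ i′ → vertex i ≢ vertex i′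
  vertex-≢ i< i′< i≢i′ e = i≢i′ (trans (≡-sym (toℕ-vertex i<)) (trans (cong toℕ e) (toℕ-vertex i′<)))

  spoke : ∀ {i} → suc i < suc m → WheelAdj (suc m) 0F (vertex (suc i))
  spoke 1+i< = wheel-hub-dominates _ (vertex-≢ 1+i< (s≤s z≤n) λ ())

  rim-edge : ∀ {i} → suc i < suc m → WheelAdj (suc m) (vertex i) (vertex (suc i))
  rim-edge {i} 1+i< =
    vertex-≢ i< 1+i< (<⇒≢ (n<1+n i)) ,
    inj₂ (inj₂ (inj₁ (inj₁ (trans (cong suc (toℕ-vertex i<)) (≡-sym (toℕ-vertex 1+i<))))))
    where
    i< : i < suc m
    i< = <-trans (n<1+n i) 1+i<

  closing-edge : 1 < m → WheelAdj (suc m) (vertex 1) (vertex m)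
  closing-edge 1<m =
    vertex-≢ 1< (n<1+n m) (<⇒≢ 1<m) ,
    inj₂ (inj₂ (inj₁ (inj₂ (toℕ-vertex 1< , toℕ-vertex (n<1+n m)))))
    where
    1< : 1 < suc m
    1< = m<n⇒m<1+n 1<m

wheel-image⇒K3 : ∀ {n N k} → 3 ≤ n → (c : Colouring N k) → MonoHom c (W n) → MonoCopy c K3
wheel-image⇒K3 (s≤s (s≤s (s≤s _))) c (κ , h , h-mono) = monoTriangle⇒monoCopy {c = c} $
  κ , h 0F , h 1F , h 2F ,
  h-mono 0F 1F ((λ ()) , inj₁ refl) , h-mono 0F 2F ((λ ()) , inj₁ refl) ,
  h-mono 1F 2F ((λ ()) , inj₂ (inj₂ (inj₁ (inj₁ refl))))

even-wheel-image⇒diamond : ∀ {N k} t (c : Colouring N k) → MonoHom c (W (4 + t * 2)) → MonoDiamond c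
even-wheel-image⇒diamond {N} t c (κ , h , h-mono) = diamond-at (two-step-≢ rim _≟_ (suc t) rim-closes)
  where
  open WheelVertex (3 + t * 2)
  rim : ℕ → Fin N
  rim i = h (vertex (suc i))
  rim-closes : rim 0 ≢ rim (suc t * 2)
  rim-closes = proj₁ (h-mono _ _ (closing-edge (s≤s (s≤s z≤n))))
  diamond-at : (∃ λ i → i < suc t × rim (i * 2) ≢ rim (2 + i * 2)) → MonoDiamond c
  diamond-at (i , i<1+t , ends≢) =
    κ , h 0F , h (vertex (2 + i * 2)) , h (vertex (1 + i * 2)) , h (vertex (3 + i * 2)) ,
    h-mono _ _ (spoke 2+2i<) , h-mono _ _ (spoke 1+2i<) , h-mono _ _ (spoke 3+2i<) ,
    MonoEdge-sym c (h-mono _ _ (rim-edge 2+2i<)) , h-mono _ _ (rim-edge 3+2i<) , ends≢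
    where
    3+2i< : 3 + i * 2 < 4 + t * 2
    3+2i< = s≤s (s≤s (s≤s (s≤s (*-monoˡ-≤ 2 (s≤s⁻¹ i<1+t)))))
    2+2i< : 2 + i * 2 < 4 + t * 2
    2+2i< = <-trans (n<1+n _) 3+2i<
    1+2i< : 1 + i * 2 < 4 + t * 2
    1+2i< = <-trans (n<1+n _) 2+2i<

wheel-image⇒K4⁻ : ∀ {n N k} → 2 ∣ n → 4 ≤ n → (c : Colouring N k) → MonoHom c (W n) → MonoCopy c K4⁻
wheel-image⇒K4⁻ (divides (suc (suc t)) refl) _ c =
  monoDiamond⇒monoCopy {c = c} ∘ even-wheel-image⇒diamond t c
wheel-image⇒K4⁻ (divides 1 refl) (s≤s (s≤s ()))
wheel-image⇒K4⁻ (divides 0 refl) ()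

theorem1p5 : ∀ (k n : ℕ) → 2 ≤ k → 4 ≤ n →
    ∀ (ℓ : ℕ) → 1 ≤ ℓ → ℓ ≤ k ∸ 1 →
    ∀ (Rk Rl : ℕ) → IsRamseyNumber k (W n) Rk → IsRamseyNumber ℓ (W n) Rl →
    (2 ∣ n → ∀ (A : ℕ) → IsRamseyNumber (k ∸ ℓ) K4⁻ A → (A ∸ 1) * (Rl ∸ 1) ≤ Rk ∸ 1)
    × (¬ (2 ∣ n) → ∀ (A : ℕ) → IsRamseyNumber (k ∸ ℓ) K3 A → (A ∸ 1) * (Rl ∸ 1) ≤ Rk ∸ 1)
theorem1p5 _ 0 _ () _ _ _ _ _ _ _
theorem1p5 k (suc n) _ 4≤n ℓ _ ℓ≤k∸1 Rk Rl (Rk→W , _) Rl-ramsey = even , odd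
  where
  split-palette : k ≡ ℓ + (k ∸ ℓ)
  split-palette = ≡-sym (m+[n∸m]≡n (≤-trans ℓ≤k∸1 (m∸n≤m k 1)))
  Rk→W′ : Arrows Rk (ℓ + (k ∸ ℓ)) (W (suc n))
  Rk→W′ = subst (λ k′ → Arrows Rk k′ (W (suc n))) split-palette Rk→W
  even : 2 ∣ suc n → ∀ A → IsRamseyNumber (k ∸ ℓ) K4⁻ A → (A ∸ 1) * (Rl ∸ 1) ≤ Rk ∸ 1
  even 2∣n A A-ramsey = ramsey-product-bound wheel-hub-dominates monoK4⁻? (wheel-image⇒K4⁻ 2∣n 4≤n)
    A-ramsey Rl-ramsey Rk→W′
  odd : ¬ (2 ∣ suc n) → ∀ A → IsRamseyNumber (k ∸ ℓ) K3 A → (A ∸ 1) * (Rl ∸ 1) ≤ Rk ∸ 1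
  odd _ A A-ramsey = ramsey-product-bound wheel-hub-dominates monoK3? (wheel-image⇒K3 (<⇒≤ 4≤n))
    A-ramsey Rl-ramsey Rk→W′
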